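{- Every cuspidal skew shape is a ribbon.
   Context: Nodes are elements of $\mathbb{Z}\times\mathbb{Z}$; $u=(u_1,u_2)$ lies in row $u_1$ (increasing southward), column $u_2$ (increasing eastward). $u\searrow v$ means $v=u+(k,\ell)$, $k,\ell\ge0$. A finite set $\tau$ of nodes is a skew shape if $u,w\in\tau$, $u\searrow v\searrow w$ imply $v\in\tau$; connected if any two nodes are joined by a path of unit horizontal/vertical steps in $\tau$; thin if it meets each diagonal $\{u:u_2-u_1=n\}$ in at most one node. A ribbon is a nonempty thin connected skew shape. Fix $e\ge2$; $\alpha_t$ ($t\in\mathbb{Z}_e$) basis of a free $\mathbb{Z}$-module; $\alpha(t,h)=\sum_{i=0}^{h-1}\alpha_{t+\bar i}$; $\delta=\sum_t\alpha_t$; $\Phi_+=\{\alpha(t,h)\mid t\in\mathbb{Z}_e,h\in\mathbb{N}\}$; imaginary roots $m\delta$, others real. Fix a convex preorder $\succeq$ on $\Phi_+$ (reflexive, transitive, total; $\beta\succeq\gamma$, $\beta+\gamma\in\Phi_+$ imply $\beta\succeq\beta+\gamma\succeq\gamma$; ($\beta\succeq\gamma$ and $\gamma\succeq\beta$) iff $\beta=\gamma$ or both imaginary); $\succ$ strict part. $\operatorname{res}(u)=\overline{u_2-u_1}$, ${\operatorname{cont}}(\tau)=\sum_{u\in\tau}\alpha_{\operatorname{res}(u)}$. A tableau $(\lambda_1,\lambda_2)$ for a skew shape $\tau$ is a pair of disjoint nonempty skew shapes with union $\tau$ such that no $u\in\lambda_2$, $v\in\lambda_1$ satisfy $u\searrow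 v$. A skew shape $\tau$ with ${\operatorname{cont}}(\tau)=\beta\in\Phi_+$ is cuspidal if for every tableau $(\lambda_1,\lambda_2)$ for $\tau$, ${\operatorname{cont}}(\lambda_1)$ is a sum of positive roots each $\prec\beta$ and ${\operatorname{cont}}(\lambda_2)$ is a sum of positive roots each $\succ\beta$. -}

module Defs where

open import Data.Nat as ℕ using (ℕ; zero; suc; NonZero; _≤_)
open import Data.Integer as ℤ using (ℤ; +_; _%ℕ_)
open import Data.Integer.DivMod using (n%ℕd<d)
open import Data.Fin using (Fin; toℕ; fromℕ<)
open import Data.Vec using (Vec; replicate; zipWith; tabulate)
open import Data.List using (List; []; _∷_; foldr)
open import Data.List.Membership.Propositional using (_∈_)
open import Data.List.Relation.Unary.All using (All)
open import Data.List.Relation.Unary.Unique.Propositional using (Unique)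
open import Data.Product using (Σ; ∃; ∃-syntax; _×_; _,_; proj₁; proj₂)
open import Data.Sum using (_⊎_)
open import Relation.Binary.PropositionalEquality using (_≡_; _≢_)
open import Relation.Nullary using (¬_)
open import Relation.Binary.Construct.Closure.ReflexiveTransitive using (Star)
open import Function.Bundles using (_⇔_)

Node : Set
Node = ℤ × ℤ

row col : Node → ℤ
row = proj₁
col = proj₂

_↘_ : Node → Node → Set
u ↘ v = ∃[ k ] ∃[ ℓ ] (v ≡ (row u ℤ.+ + k , col u ℤ.+ + ℓ))

FinSet : List Node → Set
FinSet τ = Unique τ

IsSkewShape : List Node → Set
IsSkewShape τ = FinSet τ ×
  (∀ u v w → u ∈ τ → w ∈ τ → u ↘ v → v ↘ w → v ∈ τ)

diag : Node → ℤ
diag u = col u ℤ.- row u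

UnitStep : Node → Node → Set
UnitStep u v = (row u ≡ row v × (col v ≡ col u ℤ.+ ℤ.1ℤ ⊎ col u ≡ col v ℤ.+ ℤ.1ℤ))
             ⊎ (col u ≡ col v × (row v ≡ row u ℤ.+ ℤ.1ℤ ⊎ row u ≡ row v ℤ.+ ℤ.1ℤ))

StepIn : List Node → Node → Node → Set
StepIn τ u v = u ∈ τ × v ∈ τ × UnitStep u v

IsConnected : List Node → Set
IsConnected τ = ∀ u v → u ∈ τ → v ∈ τ → Star (StepIn τ) u v

IsThin : List Node → Set
IsThin τ = ∀ u v → u ∈ τ → v ∈ τ → diag u ≡ diag v → u ≡ v

NonEmpty : List Node → Set
NonEmpty τ = ∃[ u ] (u ∈ τ)

IsRibbon : List Node → Set
IsRibbon τ = NonEmpty τ × IsThin τ × IsConnected τ × IsSkewShape τ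

-- Root lattice: ⊕_{t ∈ ℤ_e} ℤ α_t ; elements of the positive cone are
-- coordinate vectors Vec ℕ e (all contents / roots below are ≥ 0).

Wt : ℕ → Set
Wt e = Vec ℕ e

_⊕_ : ∀ {e} → Wt e → Wt e → Wt e
_⊕_ = zipWith ℕ._+_

𝟎 : ∀ {e} → Wt e
𝟎 = replicate _ 0

wsum : ∀ {e} → List (Wt e) → Wt e
wsum = foldr _⊕_ 𝟎

resℤ : (e : ℕ) .{{_ : NonZero e}} → ℤ → Fin e
resℤ e n = fromℕ< (n%ℕd<d n e)

resℕ : (e : ℕ) .{{_ : NonZero e}} → ℕ → Fin e
resℕ e n = resℤ e (+ n)

αs : (e : ℕ) → Fin e → Wt e
αs e t = tabulate (λ s → indicator s)
  where
  open import Relation.Nullary using (does)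
  open import Data.Fin using (_≟_)
  open import Data.Bool using (if_then_else_)
  indicator : Fin e → ℕ
  indicator s = if does (s ≟ t) then 1 else 0

αth : (e : ℕ) .{{_ : NonZero e}} → Fin e → ℕ → Wt e
αth e t zero    = 𝟎
αth e t (suc h) = αth e t h ⊕ αs e (resℕ e (toℕ t ℕ.+ h))

δ : (e : ℕ) → Wt e
δ e = replicate e 1

_·_ : ∀ {e} → ℕ → Wt e → Wt e
m · β = Data.Vec.map (m ℕ.*_) β
  where import Data.Vec

IsPosRoot : (e : ℕ) .{{_ : NonZero e}} → Wt e → Set
IsPosRoot e β = ∃[ t ] ∃[ h ] (1 ≤ h × β ≡ αth e t h)

IsImag : (e : ℕ) → Wt e → Set
IsImag e β = ∃[ m ] (1 ≤ m × β ≡ m · δ e)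

-- Convex preorders on Φ₊ (the relation is only constrained on Φ₊)

record ConvexPreorder (e : ℕ) .{{_ : NonZero e}} : Set₁ where
  field
    _≽_     : Wt e → Wt e → Set
    refl≽   : ∀ β → IsPosRoot e β → β ≽ β
    trans≽  : ∀ β γ η → IsPosRoot e β → IsPosRoot e γ → IsPosRoot e η →
              β ≽ γ → γ ≽ η → β ≽ η
    total≽  : ∀ β γ → IsPosRoot e β → IsPosRoot e γ → (β ≽ γ) ⊎ (γ ≽ β)
    convex  : ∀ β γ → IsPosRoot e β → IsPosRoot e γ → IsPosRoot e (β ⊕ γ) →
              β ≽ γ → (β ≽ (β ⊕ γ)) × ((β ⊕ γ) ≽ γ)
    equiv≽  : ∀ β γ → IsPosRoot e β → IsPosRoot e γ →
              ((β ≽ γ) × (γ ≽ β)) ⇔ ((β ≡ γ) ⊎ (IsImag e β × IsImag e γ))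

  _≻_ : Wt e → Wt e → Set
  β ≻ γ = (β ≽ γ) × ¬ (γ ≽ β)

  _≺_ : Wt e → Wt e → Set
  β ≺ γ = γ ≻ β

cont : (e : ℕ) .{{_ : NonZero e}} → List Node → Wt e
cont e []      = 𝟎
cont e (u ∷ τ) = αs e (resℤ e (diag u)) ⊕ cont e τ

IsTableau : List Node → List Node → List Node → Set
IsTableau τ λ₁ λ₂ =
  IsSkewShape λ₁ × IsSkewShape λ₂ × NonEmpty λ₁ × NonEmpty λ₂ ×
  (∀ u → u ∈ λ₁ → ¬ (u ∈ λ₂)) ×
  (∀ u → u ∈ τ ⇔ (u ∈ λ₁ ⊎ u ∈ λ₂)) ×
  (∀ u v → u ∈ λ₂ → v ∈ λ₁ → ¬ (u ↘ v))

SumOfRootsWith : (e : ℕ) .{{_ : NonZero e}} → (Wt e → Set) → Wt e → Set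
SumOfRootsWith e P x =
  ∃[ βs ] (All (IsPosRoot e) βs × All P βs × wsum βs ≡ x)

IsCuspidal : (e : ℕ) .{{_ : NonZero e}} → ConvexPreorder e → List Node → Set
IsCuspidal e P τ =
  IsSkewShape τ × IsPosRoot e (cont e τ) ×
  (∀ λ₁ λ₂ → IsTableau τ λ₁ λ₂ →
     SumOfRootsWith e (λ γ → γ ≺ cont e τ) (cont e λ₁) ×
     SumOfRootsWith e (λ γ → γ ≻ cont e τ) (cont e λ₂))
  where open ConvexPreorder P

-- A cuspidal shape τ admits no two tableaux (λ₁ , λ₂), (μ₁ , μ₂) with cont λ₁ + cont μ₁ = cont τ:
-- both contents would be sums of roots ≺ β = cont τ, so β itself would be such a sum, and a
-- positive root never is. For the latter, peel off a summand γ that begins where β begins (for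
-- imaginary β every residue is a beginning): then γ = β, or β = γ + β′ for a shorter root β′, and
-- convexity gives γ ≽ β or β′ ≽ β; in the second case all remaining summands are ≺ β′ and sum to β′.
--
-- Connectedness: if no node in rows ≤ r lies weakly west of a node in rows > r, both "rows ≤ r" and
-- "rows > r" are first parts of tableaux; such a pair of nodes, on the other hand, forces a vertical
-- step between rows r and r + 1 inside τ. Thinness: the nodes whose diagonal successor lies in τ
-- and the nodes whose diagonal predecessor does not are first parts of tableaux, and the complement
-- of the latter is the diagonal shift of the former, so their contents again add up to cont τ.

module Submission where

open import Defs

open import Algebra.Structures using (IsCommutativeMonoid)
open import Data.Bool using (if_then_else_)
open import Data.Empty using (⊥; ⊥-elim)
open import Data.Fin as Fin using (Fin; toℕ)
open import Data.Fin.Properties using (toℕ-injective; toℕ-fromℕ<; toℕ<n)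
open import Data.Integer as ℤ using (ℤ; 0ℤ; 1ℤ; -1ℤ)
import Data.Integer.Properties as ℤ
open import Data.Integer.Tactic.RingSolver using (solve-∀)
open import Data.List as List using (List; []; _∷_; _++_)
open import Data.List.Extrema ℤ.≤-totalOrder
  using (argmax; argmin; argmax-all; argmin-all; f[xs]≤f[argmax]; f[argmin]≤f[xs])
open import Data.List.Membership.Propositional using (_∈_; _∉_; find; lose)
open import Data.List.Membership.Propositional.Properties
  using (++-∈⇔; ∈-filter⁺; ∈-filter⁻; ∈-map⁺; ∈-map⁻)
open import Data.List.Membership.Propositional.Properties.WithK using (unique∧set⇒bag)
open import Data.List.Relation.Binary.BagAndSetEquality using (∼bag⇒↭)
open import Data.List.Relation.Binary.Permutation.Propositional using (_↭_; ↭⇒↭ₛ)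
import Data.List.Relation.Binary.Permutation.Propositional.Properties as ↭
open import Data.List.Relation.Binary.Permutation.Setoid.Properties using (foldr-commMonoid)
open import Data.List.Relation.Unary.All as All using (All; []; _∷_)
import Data.List.Relation.Unary.All.Properties as All
open import Data.List.Relation.Unary.Any as Any using (Any; here; there; _─_)
open import Data.List.Relation.Unary.Unique.Propositional using (Unique)
import Data.List.Relation.Unary.Unique.Propositional.Properties as Unique
open import Data.Nat as ℕ using (ℕ; zero; suc; NonZero; _+_; _∸_; _≤_; _<_; z<s; z≤n; s≤s; _%_)
open import Data.Nat.DivMod using (m<n⇒m%n≡m; %-distribˡ-+; m%n%n≡m%n; [m+n]%n≡m%n)
open import Data.Nat.Induction using (<-wellFounded)
open import Data.Nat.Properties
open import Algebra.Properties.CommutativeSemigroup +-commutativeSemigroup using (xy∙z≈xz∙y)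
open import Data.Product using (_,_; proj₁; proj₂; _×_; ∃-syntax)
open import Data.Product.Properties using (≡-dec)
open import Data.Sum using (_⊎_; inj₁; inj₂; [_,_])
open import Data.Vec using (lookup; _∷_; [])
open import Data.Vec.Properties
  using ( lookup-zipWith; lookup-replicate; lookup∘tabulate; ∷-injective
        ; zipWith-assoc; zipWith-comm; zipWith-identityˡ; zipWith-identityʳ )
open import Function using (_∘_; id)
open import Function.Bundles using (_⇔_; mk⇔)
open import Function.Properties.Equivalence using () renaming (trans to ⇔-trans; sym to ⇔-sym)
open import Induction.WellFounded using (Acc; acc)
open import Relation.Binary.Construct.Closure.ReflexiveTransitive as Star using (Star; ε; _◅_; _◅◅_)
open import Relation.Binary.Definitions using (DecidableEquality)
open import Relation.Binary.PropositionalEquality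
  using (_≡_; _≢_; refl; sym; trans; cong; cong₂; subst; setoid; isEquivalence; module ≡-Reasoning)
open import Relation.Nullary using (¬_; Dec; yes; no; does; ¬?)
open import Relation.Nullary.Decidable using (_×-dec_; decidable-stable)
open import Relation.Unary using (Decidable)

module _ {e : ℕ} where

  lookup-⊕ : ∀ (x y : Wt e) s → lookup (x ⊕ y) s ≡ lookup x s + lookup y s
  lookup-⊕ x y s = lookup-zipWith _+_ s x y

  lookup-𝟎 : ∀ s → lookup (𝟎 {e}) s ≡ 0
  lookup-𝟎 s = lookup-replicate s 0

  ⊕-isCommutativeMonoid : IsCommutativeMonoid _≡_ (_⊕_ {e}) 𝟎
  ⊕-isCommutativeMonoid = record
    { isMonoid = record
      { isSemigroup = record
        { isMagma = record { isEquivalence = isEquivalence ; ∙-cong = cong₂ _⊕_ }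
        ; assoc = zipWith-assoc +-assoc }
      ; identity = zipWith-identityˡ +-identityˡ , zipWith-identityʳ +-identityʳ }
    ; comm = zipWith-comm +-comm }

  open IsCommutativeMonoid ⊕-isCommutativeMonoid public using ()
    renaming (assoc to ⊕-assoc; comm to ⊕-comm; identityˡ to ⊕-identityˡ; identityʳ to ⊕-identityʳ)

wsum-++ : ∀ {e} (xs ys : List (Wt e)) → wsum (xs ++ ys) ≡ wsum xs ⊕ wsum ys
wsum-++ []       ys = sym (⊕-identityˡ _)
wsum-++ (x ∷ xs) ys = trans (cong (x ⊕_) (wsum-++ xs ys)) (sym (⊕-assoc x _ _))

wsum-↭ : ∀ {e} {xs ys : List (Wt e)} → xs ↭ ys → wsum xs ≡ wsum ys
wsum-↭ p = foldr-commMonoid (setoid _) ⊕-isCommutativeMonoid (↭⇒↭ₛ p)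

wsum-─ : ∀ {e} {x : Wt e} xs (p : x ∈ xs) → wsum xs ≡ x ⊕ wsum (xs ─ p)
wsum-─ (x ∷ xs) (here refl) = refl
wsum-─ {x = x} (y ∷ xs) (there p) = begin
  y ⊕ wsum xs              ≡⟨ cong (y ⊕_) (wsum-─ xs p) ⟩
  y ⊕ (x ⊕ wsum (xs ─ p))  ≡⟨ ⊕-assoc y x _ ⟨
  (y ⊕ x) ⊕ wsum (xs ─ p)  ≡⟨ cong (_⊕ wsum (xs ─ p)) (⊕-comm y x) ⟩
  (x ⊕ y) ⊕ wsum (xs ─ p)  ≡⟨ ⊕-assoc x y _ ⟩
  x ⊕ (y ⊕ wsum (xs ─ p))  ∎
  where open ≡-Reasoning

⊕-cancelˡ : ∀ {e} (x y z : Wt e) → x ⊕ y ≡ x ⊕ z → y ≡ z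
⊕-cancelˡ []      []      []      _  = refl
⊕-cancelˡ (a ∷ x) (b ∷ y) (c ∷ z) eq with ∷-injective eq
... | a+b≡a+c , x⊕y≡x⊕z = cong₂ _∷_ (+-cancelˡ-≡ a b c a+b≡a+c) (⊕-cancelˡ x y z x⊕y≡x⊕z)

x⊕y≡𝟎⇒x≡𝟎 : ∀ {e} (x y : Wt e) → x ⊕ y ≡ 𝟎 → x ≡ 𝟎
x⊕y≡𝟎⇒x≡𝟎 []      []      _  = refl
x⊕y≡𝟎⇒x≡𝟎 (a ∷ x) (b ∷ y) eq with ∷-injective eq
... | a+b≡0 , x⊕y≡𝟎 = cong₂ _∷_ (m+n≡0⇒m≡0 a a+b≡0) (x⊕y≡𝟎⇒x≡𝟎 x y x⊕y≡𝟎)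

x≡x⊕y⊕z⇒y≡𝟎 : ∀ {e} (x y z : Wt e) → x ≡ (x ⊕ y) ⊕ z → y ≡ 𝟎
x≡x⊕y⊕z⇒y≡𝟎 x y z eq = x⊕y≡𝟎⇒x≡𝟎 y z (sym (⊕-cancelˡ x 𝟎 (y ⊕ z) (begin
  x ⊕ 𝟎          ≡⟨ ⊕-identityʳ x ⟩
  x              ≡⟨ eq ⟩
  (x ⊕ y) ⊕ z    ≡⟨ ⊕-assoc x y z ⟩
  x ⊕ (y ⊕ z)    ∎)))
  where open ≡-Reasoning

lookup-wsum-<⇒Any : ∀ {e} (γs : List (Wt e)) a b → lookup (wsum γs) a < lookup (wsum γs) b →
                    Any (λ γ → lookup γ a < lookup γ b) γs
lookup-wsum-<⇒Any []       a b lt = ⊥-elim (<-irrefl (trans (lookup-𝟎 a) (sym (lookup-𝟎 b))) lt)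
lookup-wsum-<⇒Any (γ ∷ γs) a b lt with lookup γ a <? lookup γ b
... | yes γ-rises = here γ-rises
... | no γ-falls  = there (lookup-wsum-<⇒Any γs a b (≰⇒> λ rest-falls → <⇒≱ lt (begin
  lookup (γ ⊕ wsum γs) b               ≡⟨ lookup-⊕ γ (wsum γs) b ⟩
  lookup γ b + lookup (wsum γs) b      ≤⟨ +-mono-≤ (≮⇒≥ γ-falls) rest-falls ⟩
  lookup γ a + lookup (wsum γs) a      ≡⟨ lookup-⊕ γ (wsum γs) a ⟨
  lookup (γ ⊕ wsum γs) a               ∎)))
  where open ≤-Reasoning

<⇒∃+suc : ∀ {m n} → m < n → ∃[ o ] n ≡ m + suc o
<⇒∃+suc {m} m<n with m≤n⇒∃[o]m+o≡n m<n
... | o , refl = o , sym (+-suc m o)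

module Residues (e : ℕ) .{{_ : NonZero e}} where

  infixl 6 _+ᶠ_
  _+ᶠ_ : Fin e → ℕ → Fin e
  t +ᶠ k = resℕ e (toℕ t + k)

  private
    toℕ-resℕ : ∀ n → toℕ (resℕ e n) ≡ n % e
    toℕ-resℕ n = toℕ-fromℕ< _

    resℕ-cong : ∀ {m n} → m % e ≡ n % e → resℕ e m ≡ resℕ e n
    resℕ-cong eq = toℕ-injective (trans (toℕ-resℕ _) (trans eq (sym (toℕ-resℕ _))))

    resℕ-toℕ : ∀ t → resℕ e (toℕ t) ≡ t
    resℕ-toℕ t = toℕ-injective (trans (toℕ-resℕ _) (m<n⇒m%n≡m (toℕ<n t)))

  +ᶠ-identityʳ : ∀ t → t +ᶠ 0 ≡ t
  +ᶠ-identityʳ t = trans (cong (resℕ e) (+-identityʳ _)) (resℕ-toℕ t)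

  +ᶠ-assoc : ∀ t m n → t +ᶠ m +ᶠ n ≡ t +ᶠ (m + n)
  +ᶠ-assoc t m n = resℕ-cong (begin
    (toℕ (t +ᶠ m) + n) % e             ≡⟨ cong (λ x → (x + n) % e) (toℕ-resℕ _) ⟩
    ((toℕ t + m) % e + n) % e          ≡⟨ %-distribˡ-+ _ n e ⟩
    ((toℕ t + m) % e % e + n % e) % e  ≡⟨ cong (λ x → (x + n % e) % e) (m%n%n≡m%n _ e) ⟩
    ((toℕ t + m) % e + n % e) % e      ≡⟨ %-distribˡ-+ _ n e ⟨
    (toℕ t + m + n) % e                ≡⟨ cong (_% e) (+-assoc (toℕ t) m n) ⟩
    (toℕ t + (m + n)) % e              ∎)
    where open ≡-Reasoning

  +ᶠ-comm : ∀ t m n → t +ᶠ m +ᶠ n ≡ t +ᶠ n +ᶠ m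
  +ᶠ-comm t m n = trans (+ᶠ-assoc t m n) (trans (cong (t +ᶠ_) (+-comm m n)) (sym (+ᶠ-assoc t n m)))

  +ᶠ-period : ∀ t → t +ᶠ e ≡ t
  +ᶠ-period t = trans (resℕ-cong ([m+n]%n≡m%n (toℕ t) e)) (resℕ-toℕ t)

  +ᶠ-reach : ∀ t u → ∃[ k ] t +ᶠ k ≡ u
  +ᶠ-reach t u = e ∸ toℕ t + toℕ u , (begin
    t +ᶠ (e ∸ toℕ t + toℕ u)              ≡⟨ cong (resℕ e) (+-assoc (toℕ t) _ _) ⟨
    resℕ e (toℕ t + (e ∸ toℕ t) + toℕ u)  ≡⟨ cong (λ n → resℕ e (n + toℕ u)) t+[e∸t]≡e ⟩
    resℕ e (e + toℕ u)                    ≡⟨ cong (resℕ e) (+-comm e _) ⟩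
    u +ᶠ e                                ≡⟨ +ᶠ-period u ⟩
    u                                     ∎)
    where
    open ≡-Reasoning
    t+[e∸t]≡e : toℕ t + (e ∸ toℕ t) ≡ e
    t+[e∸t]≡e = m+[n∸m]≡n (<⇒≤ (toℕ<n t))

  pred : Fin e → Fin e
  pred s = s +ᶠ (e ∸ 1)

  pred-+ᶠ1 : ∀ s → pred (s +ᶠ 1) ≡ s
  pred-+ᶠ1 s = trans (+ᶠ-assoc s 1 _) (trans (cong (s +ᶠ_) 1+[e∸1]≡e) (+ᶠ-period s))
    where
    1+[e∸1]≡e : 1 + (e ∸ 1) ≡ e
    1+[e∸1]≡e = m+[n∸m]≡n {1} {e} (ℕ.>-nonZero⁻¹ e)

  +ᶠ1-pred : ∀ s → pred s +ᶠ 1 ≡ s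
  +ᶠ1-pred s = trans (+ᶠ-comm s _ 1) (pred-+ᶠ1 s)

module Roots (e : ℕ) .{{_ : NonZero e}} where

  open Residues e

  α : Fin e → ℕ → Wt e
  α = αth e

  αth-+ : ∀ t m n → α t (m + n) ≡ α t m ⊕ α (t +ᶠ m) n
  αth-+ t m zero    = trans (cong (α t) (+-identityʳ m)) (sym (⊕-identityʳ _))
  αth-+ t m (suc n) = begin
    α t (m + suc n)                              ≡⟨ cong (α t) (+-suc m n) ⟩
    α t (m + n) ⊕ αs e (t +ᶠ (m + n))            ≡⟨ cong (λ r → α t (m + n) ⊕ αs e r) (+ᶠ-assoc t m n) ⟨
    α t (m + n) ⊕ αs e (t +ᶠ m +ᶠ n)             ≡⟨ cong (_⊕ αs e (t +ᶠ m +ᶠ n)) (αth-+ t m n) ⟩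
    (α t m ⊕ α (t +ᶠ m) n) ⊕ αs e (t +ᶠ m +ᶠ n)  ≡⟨ ⊕-assoc (α t m) _ _ ⟩
    α t m ⊕ α (t +ᶠ m) (suc n)                   ∎
    where open ≡-Reasoning

  αth-1 : ∀ t → α t 1 ≡ αs e t
  αth-1 t = trans (⊕-identityˡ _) (cong (αs e) (+ᶠ-identityʳ t))

  indicator : Fin e → Fin e → ℕ
  indicator s t = if does (s Fin.≟ t) then 1 else 0

  lookup-αs : ∀ t s → lookup (αs e t) s ≡ indicator s t
  lookup-αs t s = lookup∘tabulate _ s

  indicator-refl : ∀ s → indicator s s ≡ 1
  indicator-refl s with s Fin.≟ s
  ... | yes _  = refl
  ... | no s≢s = ⊥-elim (s≢s refl)

  indicator-≢ : ∀ {s t} → s ≢ t → indicator s t ≡ 0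
  indicator-≢ {s} {t} s≢t with s Fin.≟ t
  ... | yes s≡t = ⊥-elim (s≢t s≡t)
  ... | no _    = refl

  indicator-cong : ∀ {s t s′ t′} → (s ≡ t → s′ ≡ t′) → (s′ ≡ t′ → s ≡ t) →
                   indicator s t ≡ indicator s′ t′
  indicator-cong {s} {t} {s′} {t′} to from with s Fin.≟ t | s′ Fin.≟ t′
  ... | yes _ | yes _ = refl
  ... | no _  | no _  = refl
  ... | yes p | no ¬q = ⊥-elim (¬q (to p))
  ... | no ¬p | yes q = ⊥-elim (¬p (from q))

  indicator-+ᶠ1 : ∀ s r → indicator s (r +ᶠ 1) ≡ indicator (pred s) r
  indicator-+ᶠ1 s r = indicator-cong (λ s≡r+1 → trans (cong pred s≡r+1) (pred-+ᶠ1 r))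
                                     (λ pred-s≡r → trans (sym (+ᶠ1-pred s)) (cong (_+ᶠ 1) pred-s≡r))

  lookup-αth-suc : ∀ t h s → lookup (α t (suc h)) s ≡ lookup (α t h) s + indicator s (t +ᶠ h)
  lookup-αth-suc t h s = trans (lookup-⊕ (α t h) _ s) (cong (lookup (α t h) s +_) (lookup-αs _ s))

  lookup-αth-pred : ∀ t h s →
                    lookup (α t h) s + indicator s (t +ᶠ h) ≡ lookup (α t h) (pred s) + indicator s t
  lookup-αth-pred t zero s =
    cong₂ _+_ (trans (lookup-𝟎 s) (sym (lookup-𝟎 (pred s)))) (cong (indicator s) (+ᶠ-identityʳ t))
  lookup-αth-pred t (suc h) s = begin
    lookup (α t (suc h)) s + 𝟙[s≡end]      ≡⟨ cong (_+ 𝟙[s≡end]) (lookup-αth-suc t h s) ⟩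
    L s + indicator s r + 𝟙[s≡end]          ≡⟨ cong (_+ 𝟙[s≡end]) (lookup-αth-pred t h s) ⟩
    L (pred s) + indicator s t + 𝟙[s≡end]   ≡⟨ xy∙z≈xz∙y (L (pred s)) _ _ ⟩
    L (pred s) + 𝟙[s≡end] + indicator s t   ≡⟨ cong (λ i → L (pred s) + i + indicator s t) end-shift ⟩
    L (pred s) + indicator (pred s) r + indicator s t
                                            ≡⟨ cong (_+ indicator s t) (lookup-αth-suc t h (pred s)) ⟨
    lookup (α t (suc h)) (pred s) + indicator s t  ∎
    where
    open ≡-Reasoning
    L : Fin e → ℕ
    L = lookup (α t h)
    r : Fin e
    r = t +ᶠ h
    𝟙[s≡end] : ℕ
    𝟙[s≡end] = indicator s (t +ᶠ suc h)
    end-shift : 𝟙[s≡end] ≡ indicator (pred s) r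
    end-shift = trans (cong (λ k → indicator s (t +ᶠ k)) (+-comm 1 h))
                      (trans (cong (indicator s) (sym (+ᶠ-assoc t h 1))) (indicator-+ᶠ1 s r))

  αth-rises-only-at-start : ∀ t h s → lookup (α t h) (pred s) < lookup (α t h) s → s ≡ t
  αth-rises-only-at-start t h s rise with s Fin.≟ t
  ... | yes s≡t = s≡t
  ... | no s≢t  = ⊥-elim (<⇒≱ rise (begin
    lookup (α t h) s                          ≤⟨ m≤m+n _ _ ⟩
    lookup (α t h) s + indicator s (t +ᶠ h)   ≡⟨ lookup-αth-pred t h s ⟩
    lookup (α t h) (pred s) + indicator s t   ≡⟨ cong (lookup (α t h) (pred s) +_) (indicator-≢ s≢t) ⟩
    lookup (α t h) (pred s) + 0               ≡⟨ +-identityʳ _ ⟩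
    lookup (α t h) (pred s)                   ∎))
    where open ≤-Reasoning

  αth-rises-at-start : ∀ t h → t +ᶠ h ≢ t → lookup (α t h) (pred t) < lookup (α t h) t
  αth-rises-at-start t h end≢t = begin-strict
    lookup (α t h) (pred t)                   <⟨ m<m+n _ z<s ⟩
    lookup (α t h) (pred t) + 1               ≡⟨ cong (lookup (α t h) (pred t) +_) (indicator-refl t) ⟨
    lookup (α t h) (pred t) + indicator t t   ≡⟨ lookup-αth-pred t h t ⟨
    lookup (α t h) t + indicator t (t +ᶠ h)   ≡⟨ cong (lookup (α t h) t +_) (indicator-≢ (end≢t ∘ sym)) ⟩
    lookup (α t h) t + 0                      ≡⟨ +-identityʳ _ ⟩
    lookup (α t h) t                          ∎
    where open ≤-Reasoning

  αth-suc≢𝟎 : ∀ t h → α t (suc h) ≢ 𝟎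
  αth-suc≢𝟎 t h α≡𝟎 = 1+n≢0 (begin
    1                  ≡⟨ indicator-refl t ⟨
    indicator t t      ≡⟨ lookup-αs t t ⟨
    lookup (αs e t) t  ≡⟨ cong (λ β → lookup β t) αs≡𝟎 ⟩
    lookup (𝟎 {e}) t   ≡⟨ lookup-𝟎 t ⟩
    0                  ∎)
    where
    open ≡-Reasoning
    αs≡𝟎 : αs e t ≡ 𝟎
    αs≡𝟎 = trans (sym (αth-1 t)) (x⊕y≡𝟎⇒x≡𝟎 (α t 1) _ (trans (sym (αth-+ t 1 h)) α≡𝟎))

  posRoot≢𝟎 : ∀ {β} → IsPosRoot e β → β ≢ 𝟎
  posRoot≢𝟎 (t , suc h , _ , refl) = αth-suc≢𝟎 t h

  αth-+ᶠ1 : ∀ t h → t +ᶠ h ≡ t → α (t +ᶠ 1) h ≡ α t h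
  αth-+ᶠ1 t h end≡t = ⊕-cancelˡ (αs e t) _ _ (begin
    αs e t ⊕ α (t +ᶠ 1) h    ≡⟨ cong (_⊕ α (t +ᶠ 1) h) (αth-1 t) ⟨
    α t 1 ⊕ α (t +ᶠ 1) h     ≡⟨ αth-+ t 1 h ⟨
    α t (1 + h)              ≡⟨ cong (α t) (+-comm 1 h) ⟩
    α t (h + 1)              ≡⟨ αth-+ t h 1 ⟩
    α t h ⊕ α (t +ᶠ h) 1     ≡⟨ cong (α t h ⊕_) (trans (αth-1 _) (cong (αs e) end≡t)) ⟩
    α t h ⊕ αs e t           ≡⟨ ⊕-comm (α t h) _ ⟩
    αs e t ⊕ α t h           ∎)
    where open ≡-Reasoning

  αth-start-irrelevant : ∀ t h → t +ᶠ h ≡ t → ∀ u → α u h ≡ α t h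
  αth-start-irrelevant t h end≡t u with +ᶠ-reach t u
  ... | k , refl = rotated k
    where
    rotated : ∀ k → α (t +ᶠ k) h ≡ α t h
    rotated zero    = cong (λ u → α u h) (+ᶠ-identityʳ t)
    rotated (suc k) = begin
      α (t +ᶠ suc k) h    ≡⟨ cong (λ n → α (t +ᶠ n) h) (+-comm 1 k) ⟩
      α (t +ᶠ (k + 1)) h  ≡⟨ cong (λ u → α u h) (+ᶠ-assoc t k 1) ⟨
      α (t +ᶠ k +ᶠ 1) h   ≡⟨ αth-+ᶠ1 (t +ᶠ k) h (trans (+ᶠ-comm t k h) (cong (_+ᶠ k) end≡t)) ⟩
      α (t +ᶠ k) h        ≡⟨ rotated k ⟩
      α t h               ∎
      where open ≡-Reasoning

  summand-length-≤ : ∀ γs t h h′ (p : α t h′ ∈ γs) → wsum γs ≡ α t h → h′ ≤ h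
  summand-length-≤ γs t h h′ p sum≡ = ≮⇒≥ longer-impossible
    where
    R : Wt e
    R = wsum (γs ─ p)
    longer-impossible : h < h′ → ⊥
    longer-impossible h<h′ with <⇒∃+suc h<h′
    ... | o , h′≡ = αth-suc≢𝟎 (t +ᶠ h) o (x≡x⊕y⊕z⇒y≡𝟎 (α t h) _ R (begin
      α t h                             ≡⟨ sum≡ ⟨
      wsum γs                           ≡⟨ wsum-─ γs p ⟩
      α t h′ ⊕ R                        ≡⟨ cong (λ n → α t n ⊕ R) h′≡ ⟩
      α t (h + suc o) ⊕ R               ≡⟨ cong (_⊕ R) (αth-+ t h (suc o)) ⟩
      (α t h ⊕ α (t +ᶠ h) (suc o)) ⊕ R  ∎))
      where open ≡-Reasoning

  remainder-after-start : ∀ γs t h k (p : α t h ∈ γs) →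
                          wsum γs ≡ α t (h + k) → wsum (γs ─ p) ≡ α (t +ᶠ h) k
  remainder-after-start γs t h k p sum≡ =
    ⊕-cancelˡ (α t h) _ _ (trans (sym (wsum-─ γs p)) (trans sum≡ (αth-+ t h k)))

  -- t +ᶠ h ≡ t exactly when α t h is imaginary; otherwise coordinate t of α t h exceeds coordinate
  -- pred t, and only summands beginning at t can contribute such an excess.
  summand-at-start : ∀ γs → All (IsPosRoot e) γs → ∀ t h → 1 ≤ h → wsum γs ≡ α t h →
                     ∃[ t′ ] α t h ≡ α t′ h × ∃[ h′ ] 1 ≤ h′ × α t′ h′ ∈ γs
  summand-at-start γs roots t h 1≤h sum≡α with t +ᶠ h Fin.≟ t
  ... | no end≢t = t , refl , summand-rising-at-t
    where
    rise : lookup (wsum γs) (pred t) < lookup (wsum γs) t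
    rise = subst (λ β → lookup β (pred t) < lookup β t) (sym sum≡α) (αth-rises-at-start t h end≢t)
    summand-rising-at-t : ∃[ h′ ] 1 ≤ h′ × α t h′ ∈ γs
    summand-rising-at-t with find (lookup-wsum-<⇒Any γs (pred t) t rise)
    ... | γ , γ∈γs , γ-rises with All.lookup roots γ∈γs
    ... | t′ , h′ , 1≤h′ , refl with αth-rises-only-at-start t′ h′ t γ-rises
    ... | refl = h′ , 1≤h′ , γ∈γs
  summand-at-start [] [] t h 1≤h 𝟎≡α | yes _ = ⊥-elim (posRoot≢𝟎 (t , h , 1≤h , refl) (sym 𝟎≡α))
  summand-at-start (_ ∷ _) ((t′ , h′ , 1≤h′ , refl) ∷ _) t h _ _ | yes end≡t =
    t′ , sym (αth-start-irrelevant t h end≡t t′) , h′ , 1≤h′ , here refl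

module Convexity {e : ℕ} .{{_ : NonZero e}} (P : ConvexPreorder e) where

  open ConvexPreorder P
  open Residues e
  open Roots e

  ≺-≼-trans : ∀ {δ β β′} → IsPosRoot e δ → IsPosRoot e β → IsPosRoot e β′ →
              δ ≺ β → β′ ≽ β → δ ≺ β′
  ≺-≼-trans rδ rβ rβ′ (β≽δ , δ⋡β) β′≽β =
    trans≽ _ _ _ rβ′ rβ rδ β′≽β β≽δ , λ δ≽β′ → δ⋡β (trans≽ _ _ _ rδ rβ′ rβ δ≽β′ β′≽β)

  summand-≽-sum : ∀ {γ γ′} → IsPosRoot e γ → IsPosRoot e γ′ → IsPosRoot e (γ ⊕ γ′) →
                  (γ ≽ (γ ⊕ γ′)) ⊎ (γ′ ≽ (γ ⊕ γ′))
  summand-≽-sum {γ} {γ′} rγ rγ′ rγ⊕γ′ with total≽ γ γ′ rγ rγ′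
  ... | inj₁ γ≽γ′ = inj₁ (proj₁ (convex γ γ′ rγ rγ′ rγ⊕γ′ γ≽γ′))
  ... | inj₂ γ′≽γ = inj₂ (subst (γ′ ≽_) (⊕-comm γ′ γ) (proj₁ (convex γ′ γ rγ′ rγ rγ′⊕γ γ′≽γ)))
    where
    rγ′⊕γ : IsPosRoot e (γ′ ⊕ γ)
    rγ′⊕γ = subst (IsPosRoot e) (⊕-comm γ γ′) rγ⊕γ′

  private
    no-≺-decomposition : ∀ {h} → Acc _<_ h → ∀ t γs → 1 ≤ h → All (IsPosRoot e) γs →
                         All (_≺ α t h) γs → wsum γs ≢ α t h
    no-≺-decomposition {h} (acc rec) t γs 1≤h roots smaller sum≡β
      with summand-at-start γs roots t h 1≤h sum≡β
    ... | t′ , β≡ , h′ , 1≤h′ , γ∈γs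
      with m≤n⇒m<n∨m≡n (summand-length-≤ γs t′ h h′ γ∈γs (trans sum≡β β≡))
    ... | inj₂ refl =
      proj₂ (All.lookup smaller γ∈γs) (subst (α t′ h ≽_) (sym β≡) (refl≽ _ (t′ , h , 1≤h , refl)))
    ... | inj₁ h′<h with <⇒∃+suc h′<h
    ... | o , refl = split (summand-≽-sum rγ rβ′ (subst (IsPosRoot e) β≡γ⊕β′ rβ))
      where
      γ β′ : Wt e
      γ  = α t′ h′
      β′ = α (t′ +ᶠ h′) (suc o)
      rγ : IsPosRoot e γ
      rγ = t′ , h′ , 1≤h′ , refl
      rβ′ : IsPosRoot e β′
      rβ′ = t′ +ᶠ h′ , suc o , s≤s z≤n , refl
      rβ : IsPosRoot e (α t h)
      rβ = t , h , 1≤h , refl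
      β≡γ⊕β′ : α t h ≡ γ ⊕ β′
      β≡γ⊕β′ = trans β≡ (αth-+ t′ h′ (suc o))
      ≺β⇒≺β′ : β′ ≽ α t h → ∀ {δ} → IsPosRoot e δ × δ ≺ α t h → δ ≺ β′
      ≺β⇒≺β′ β′≽β (rδ , δ≺β) = ≺-≼-trans rδ rβ rβ′ δ≺β β′≽β
      split : (γ ≽ (γ ⊕ β′)) ⊎ (β′ ≽ (γ ⊕ β′)) → ⊥
      split (inj₁ γ≽β)  = proj₂ (All.lookup smaller γ∈γs) (subst (γ ≽_) (sym β≡γ⊕β′) γ≽β)
      split (inj₂ β′≽β) =
        no-≺-decomposition (rec (m<n+m (suc o) 1≤h′)) (t′ +ᶠ h′) (γs ─ γ∈γs) (s≤s z≤n)
          (All.─⁺ γ∈γs roots)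
          (All.─⁺ γ∈γs (All.zipWith (≺β⇒≺β′ (subst (β′ ≽_) (sym β≡γ⊕β′) β′≽β)) (roots , smaller)))
          (remainder-after-start γs t′ h′ (suc o) γ∈γs (trans sum≡β β≡))

  posRoot-not-sum-of-≺ : ∀ {β} γs → IsPosRoot e β → All (IsPosRoot e) γs → All (_≺ β) γs →
                         wsum γs ≢ β
  posRoot-not-sum-of-≺ γs (t , h , 1≤h , refl) = no-≺-decomposition (<-wellFounded h) t γs 1≤h

module Contents (e : ℕ) .{{_ : NonZero e}} where

  private
    simple : Node → Wt e
    simple u = αs e (resℤ e (diag u))

    cont≡wsum : ∀ τ → cont e τ ≡ wsum (List.map simple τ)
    cont≡wsum []      = refl
    cont≡wsum (u ∷ τ) = cong (simple u ⊕_) (cont≡wsum τ)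

  cont-↭ : ∀ {τ σ} → τ ↭ σ → cont e τ ≡ cont e σ
  cont-↭ {τ} {σ} τ↭σ =
    trans (cont≡wsum τ) (trans (wsum-↭ (↭.map⁺ simple τ↭σ)) (sym (cont≡wsum σ)))

  cont-++ : ∀ τ σ → cont e (τ ++ σ) ≡ cont e τ ⊕ cont e σ
  cont-++ []      σ = sym (⊕-identityˡ _)
  cont-++ (u ∷ τ) σ = trans (cong (_ ⊕_) (cont-++ τ σ)) (sym (⊕-assoc _ _ _))

  cont-map : ∀ f → (∀ u → diag (f u) ≡ diag u) → ∀ τ → cont e (List.map f τ) ≡ cont e τ
  cont-map f diag-f []      = refl
  cont-map f diag-f (u ∷ τ) = cong₂ _⊕_ (cong (αs e ∘ resℤ e) (diag-f u)) (cont-map f diag-f τ)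

  cont-sameSet : ∀ {τ σ} → Unique τ → Unique σ → (∀ {u} → u ∈ τ ⇔ u ∈ σ) → cont e τ ≡ cont e σ
  cont-sameSet uτ uσ τ≈σ = cont-↭ (∼bag⇒↭ (unique∧set⇒bag uτ uσ τ≈σ))

  cont-tableau : ∀ {τ λ₁ λ₂} → Unique τ → IsTableau τ λ₁ λ₂ → cont e τ ≡ cont e λ₁ ⊕ cont e λ₂
  cont-tableau {τ} {λ₁} {λ₂} uτ ((uλ₁ , _) , (uλ₂ , _) , _ , _ , disjoint , τ≈λ₁∪λ₂ , _) =
    trans (cont-sameSet uτ uλ₁++λ₂ (⇔-trans (τ≈λ₁∪λ₂ _) (⇔-sym ++-∈⇔))) (cont-++ λ₁ λ₂)
    where
    uλ₁++λ₂ : Unique (λ₁ ++ λ₂)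
    uλ₁++λ₂ = Unique.++⁺ uλ₁ uλ₂ (λ (u∈λ₁ , u∈λ₂) → disjoint _ u∈λ₁ u∈λ₂)

  posRoot-cont⇒nonEmpty : ∀ τ → IsPosRoot e (cont e τ) → NonEmpty τ
  posRoot-cont⇒nonEmpty []      root = ⊥-elim (Roots.posRoot≢𝟎 e root refl)
  posRoot-cont⇒nonEmpty (u ∷ _) _    = u , here refl

NWClosedIn : List Node → (Node → Set) → Set
NWClosedIn τ p = ∀ {u v} → u ∈ τ → v ∈ τ → u ↘ v → p v → p u

module _ {τ : List Node} (skew : IsSkewShape τ) where

  filter-isSkewShape : ∀ {q : Node → Set} (q? : Decidable q) →
                       (∀ {u v w} → u ∈ τ → v ∈ τ → w ∈ τ → u ↘ v → v ↘ w → q u → q w → q v) →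
                       IsSkewShape (List.filter q? τ)
  filter-isSkewShape q? q-convex = Unique.filter⁺ q? (proj₁ skew) , between
    where
    between : ∀ u v w → u ∈ List.filter q? τ → w ∈ List.filter q? τ → u ↘ v → v ↘ w →
              v ∈ List.filter q? τ
    between u v w u∈ w∈ u↘v v↘w with ∈-filter⁻ q? {xs = τ} u∈ | ∈-filter⁻ q? {xs = τ} w∈
    ... | u∈τ , qu | w∈τ , qw = ∈-filter⁺ q? v∈τ (q-convex u∈τ v∈τ w∈τ u↘v v↘w qu qw)
      where
      v∈τ : v ∈ τ
      v∈τ = proj₂ skew u v w u∈τ w∈τ u↘v v↘w

  filter-tableau : ∀ {p : Node → Set} (p? : Decidable p) → NWClosedIn τ p →
                   ∀ {u v} → u ∈ τ → p u → v ∈ τ → ¬ p v →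
                   IsTableau τ (List.filter p? τ) (List.filter (¬? ∘ p?) τ)
  filter-tableau {p} p? closed u∈τ pu v∈τ ¬pv =
    filter-isSkewShape p? (λ _ v∈τ w∈τ _ v↘w _ pw → closed v∈τ w∈τ v↘w pw) ,
    filter-isSkewShape (¬? ∘ p?) (λ u∈τ v∈τ _ u↘v _ ¬pu _ pv → ¬pu (closed u∈τ v∈τ u↘v pv)) ,
    (_ , ∈-filter⁺ p? u∈τ pu) ,
    (_ , ∈-filter⁺ (¬? ∘ p?) v∈τ ¬pv) ,
    (λ w w∈λ₁ w∈λ₂ → proj₂ (in-λ₂ w∈λ₂) (proj₂ (in-λ₁ w∈λ₁))) ,
    (λ w → mk⇔ (split w) [ proj₁ ∘ in-λ₁ , proj₁ ∘ in-λ₂ ]) ,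
    (λ w w′ w∈λ₂ w′∈λ₁ w↘w′ → let w∈τ , ¬pw = in-λ₂ w∈λ₂ ; w′∈τ , pw′ = in-λ₁ w′∈λ₁ in
                               ¬pw (closed w∈τ w′∈τ w↘w′ pw′))
    where
    in-λ₁ : ∀ {w} → w ∈ List.filter p? τ → w ∈ τ × p w
    in-λ₁ = ∈-filter⁻ p? {xs = τ}
    in-λ₂ : ∀ {w} → w ∈ List.filter (¬? ∘ p?) τ → w ∈ τ × ¬ p w
    in-λ₂ = ∈-filter⁻ (¬? ∘ p?) {xs = τ}
    split : ∀ w → w ∈ τ → w ∈ List.filter p? τ ⊎ w ∈ List.filter (¬? ∘ p?) τ
    split w w∈τ with p? w
    ... | yes pw = inj₁ (∈-filter⁺ p? w∈τ pw)
    ... | no ¬pw = inj₂ (∈-filter⁺ (¬? ∘ p?) w∈τ ¬pw)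

i<i+1 : ∀ i → i ℤ.< i ℤ.+ 1ℤ
i<i+1 i = ℤ.suc[i]≤j⇒i<j (ℤ.≤-reflexive (ℤ.+-comm 1ℤ i))

i<j⇒i+1≤j : ∀ {i j} → i ℤ.< j → i ℤ.+ 1ℤ ℤ.≤ j
i<j⇒i+1≤j {i} i<j = subst (ℤ._≤ _) (ℤ.+-comm 1ℤ i) (ℤ.i<j⇒suc[i]≤j i<j)

≤⇒∃+ : ∀ {i j} → i ℤ.≤ j → ∃[ k ] j ≡ i ℤ.+ ℤ.+ k
≤⇒∃+ {i} {j} i≤j = ℤ.∣ j ℤ.- i ∣ , (begin
  j                          ≡⟨ j≡i+[j-i] i j ⟩
  i ℤ.+ (j ℤ.- i)            ≡⟨ cong (ℤ._+_ i) (ℤ.0≤i⇒+∣i∣≡i (ℤ.i≤j⇒0≤j-i i≤j)) ⟨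
  i ℤ.+ ℤ.+ ℤ.∣ j ℤ.- i ∣    ∎)
  where
  open ≡-Reasoning
  j≡i+[j-i] : ∀ i j → j ≡ i ℤ.+ (j ℤ.- i)
  j≡i+[j-i] = solve-∀

≤⇒↘ : ∀ {u v} → row u ℤ.≤ row v → col u ℤ.≤ col v → u ↘ v
≤⇒↘ rows cols with ≤⇒∃+ rows | ≤⇒∃+ cols
... | k , row-v | ℓ , col-v = k , ℓ , cong₂ _,_ row-v col-v

↘⇒≤ : ∀ u v → u ↘ v → row u ℤ.≤ row v × col u ℤ.≤ col v
↘⇒≤ _ _ (k , ℓ , refl) = ℤ.i≤i+j _ (ℤ.+ k) , ℤ.i≤i+j _ (ℤ.+ ℓ)

shift : ℤ → Node → Node
shift d u = row u ℤ.+ d , col u ℤ.+ d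

shift-0 : ∀ u → shift 0ℤ u ≡ u
shift-0 u = cong₂ _,_ (ℤ.+-identityʳ _) (ℤ.+-identityʳ _)

shift-↘ : ∀ {i j} u → i ℤ.≤ j → shift i u ↘ shift j u
shift-↘ u i≤j = ≤⇒↘ (ℤ.+-monoʳ-≤ (row u) i≤j) (ℤ.+-monoʳ-≤ (col u) i≤j)

shift-mono : ∀ d u v → u ↘ v → shift d u ↘ shift d v
shift-mono d u v u↘v with ↘⇒≤ u v u↘v
... | rows , cols = ≤⇒↘ (ℤ.+-monoˡ-≤ d rows) (ℤ.+-monoˡ-≤ d cols)

diag≡⇒shift : ∀ u v → diag u ≡ diag v → row u ℤ.≤ row v → ∃[ k ] v ≡ shift (ℤ.+ k) u
diag≡⇒shift u v diag≡ rows with ≤⇒∃+ rows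
... | k , row-v = k , cong₂ _,_ row-v (begin
  col v                           ≡⟨ split (col v) (row v) ⟩
  diag v ℤ.+ row v                ≡⟨ cong₂ ℤ._+_ (sym diag≡) row-v ⟩
  diag u ℤ.+ (row u ℤ.+ ℤ.+ k)    ≡⟨ regroup (col u) (row u) (ℤ.+ k) ⟩
  col u ℤ.+ ℤ.+ k                 ∎)
  where
  open ≡-Reasoning
  split : ∀ c r → c ≡ c ℤ.- r ℤ.+ r
  split = solve-∀
  regroup : ∀ c r k → c ℤ.- r ℤ.+ (r ℤ.+ k) ≡ c ℤ.+ k
  regroup = solve-∀

infix 25 _⁺ _⁻
_⁺ _⁻ : Node → Node
u ⁺ = shift 1ℤ u
u ⁻ = shift -1ℤ u

⁻∘⁺ : ∀ u → u ⁺ ⁻ ≡ u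
⁻∘⁺ u = cong₂ _,_ (cancel (row u)) (cancel (col u))
  where
  cancel : ∀ i → i ℤ.+ 1ℤ ℤ.+ -1ℤ ≡ i
  cancel = solve-∀

⁺∘⁻ : ∀ u → u ⁻ ⁺ ≡ u
⁺∘⁻ u = cong₂ _,_ (cancel (row u)) (cancel (col u))
  where
  cancel : ∀ i → i ℤ.+ -1ℤ ℤ.+ 1ℤ ≡ i
  cancel = solve-∀

⁺-injective : ∀ {u v} → u ⁺ ≡ v ⁺ → u ≡ v
⁺-injective {u} {v} eq = trans (sym (⁻∘⁺ u)) (trans (cong _⁻ eq) (⁻∘⁺ v))

diag-⁺ : ∀ u → diag (u ⁺) ≡ diag u
diag-⁺ u = cancel (row u) (col u)
  where
  cancel : ∀ r c → c ℤ.+ 1ℤ ℤ.- (r ℤ.+ 1ℤ) ≡ c ℤ.- r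
  cancel = solve-∀

↘⁺ : ∀ u → u ↘ u ⁺
↘⁺ u = ≤⇒↘ (ℤ.i≤i+j (row u) 1ℤ) (ℤ.i≤i+j (col u) 1ℤ)

⁻↘ : ∀ u → u ⁻ ↘ u
⁻↘ u = subst (u ⁻ ↘_) (⁺∘⁻ u) (↘⁺ (u ⁻))

module Paths {τ : List Node} (skew : IsSkewShape τ) where

  Path : Node → Node → Set
  Path = Star (StepIn τ)

  step-sym : ∀ {u v} → StepIn τ u v → StepIn τ v u
  step-sym (u∈τ , v∈τ , inj₁ (r≡ , inj₁ c≡)) = v∈τ , u∈τ , inj₁ (sym r≡ , inj₂ c≡)
  step-sym (u∈τ , v∈τ , inj₁ (r≡ , inj₂ c≡)) = v∈τ , u∈τ , inj₁ (sym r≡ , inj₁ c≡)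
  step-sym (u∈τ , v∈τ , inj₂ (c≡ , inj₁ r≡)) = v∈τ , u∈τ , inj₂ (sym c≡ , inj₂ r≡)
  step-sym (u∈τ , v∈τ , inj₂ (c≡ , inj₂ r≡)) = v∈τ , u∈τ , inj₂ (sym c≡ , inj₁ r≡)

  path-sym : ∀ {u v} → Path u v → Path v u
  path-sym = Star.reverse step-sym

  private
    rightward-path : ∀ n {u v} → u ∈ τ → v ∈ τ → v ≡ (row u , col u ℤ.+ ℤ.+ n) → Path u v
    rightward-path zero    {u} u∈τ _   refl = subst (Path u) (cong (row u ,_) (sym (ℤ.+-identityʳ _))) ε
    rightward-path (suc n) {u} u∈τ v∈τ refl =
      (u∈τ , w∈τ , inj₁ (refl , inj₁ refl)) ◅ rightward-path n w∈τ v∈τ (cong (row u ,_) v-from-w)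
      where
      w = row u , col u ℤ.+ 1ℤ
      w∈τ : w ∈ τ
      w∈τ = proj₂ skew u w _ u∈τ v∈τ (≤⇒↘ ℤ.≤-refl (ℤ.i≤i+j (col u) 1ℤ))
              (≤⇒↘ ℤ.≤-refl (ℤ.+-monoʳ-≤ (col u) (ℤ.+≤+ (s≤s z≤n))))
      v-from-w : col u ℤ.+ ℤ.+ suc n ≡ col u ℤ.+ 1ℤ ℤ.+ ℤ.+ n
      v-from-w = sym (ℤ.+-assoc (col u) 1ℤ (ℤ.+ n))

  row-path : ∀ {u v} → u ∈ τ → v ∈ τ → row u ≡ row v → Path u v
  row-path {u} {v} u∈τ v∈τ row≡ with ℤ.≤-total (col u) (col v)
  ... | inj₁ u≤v = let k , col-v = ≤⇒∃+ u≤v in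
                   rightward-path k u∈τ v∈τ (cong₂ _,_ (sym row≡) col-v)
  ... | inj₂ v≤u = let k , col-u = ≤⇒∃+ v≤u in
                   path-sym (rightward-path k v∈τ u∈τ (cong₂ _,_ row≡ col-u))

_∈?_ : ∀ u τ → Dec (u ∈ τ)
u ∈? τ = Any.any? (u ≟ᴺ_) τ
  where
  _≟ᴺ_ : DecidableEquality Node
  _≟ᴺ_ = ≡-dec ℤ._≟_ ℤ._≟_

module Cuspidal {e : ℕ} .{{_ : NonZero e}} (P : ConvexPreorder e) {τ : List Node}
                (cusp : IsCuspidal e P τ) where

  open Convexity P
  open Contents e

  skew : IsSkewShape τ
  skew = proj₁ cusp

  open Paths skew

  between : ∀ {u v w} → u ∈ τ → w ∈ τ → u ↘ v → v ↘ w → v ∈ τ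
  between u∈τ w∈τ = proj₂ skew _ _ _ u∈τ w∈τ

  first-parts-not-complementary : ∀ {λ₁ λ₂ μ₁ μ₂} → IsTableau τ λ₁ λ₂ → IsTableau τ μ₁ μ₂ →
                                  cont e λ₁ ⊕ cont e μ₁ ≢ cont e τ
  first-parts-not-complementary {λ₁} {λ₂} {μ₁} {μ₂} Tλ Tμ cover
    with proj₁ (proj₂ (proj₂ cusp) λ₁ λ₂ Tλ) | proj₁ (proj₂ (proj₂ cusp) μ₁ μ₂ Tμ)
  ... | γs , γs-roots , γs-≺ , γs-sum | δs , δs-roots , δs-≺ , δs-sum =
    posRoot-not-sum-of-≺ (γs ++ δs) (proj₁ (proj₂ cusp)) (All.++⁺ γs-roots δs-roots) (All.++⁺ γs-≺ δs-≺)
      (trans (wsum-++ γs δs) (trans (cong₂ _⊕_ γs-sum δs-sum) cover))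

  indecomposable : ∀ {p : Node → Set} (p? : Decidable p) → NWClosedIn τ p → NWClosedIn τ (¬_ ∘ p) →
                   ∀ {u v} → u ∈ τ → p u → v ∈ τ → ¬ p v → ⊥
  indecomposable p? p-closed ¬p-closed u∈τ pu v∈τ ¬pv =
    first-parts-not-complementary Tp T¬p (sym (cont-tableau (proj₁ skew) Tp))
    where
    Tp : IsTableau τ (List.filter p? τ) (List.filter (¬? ∘ p?) τ)
    Tp = filter-tableau skew p? p-closed u∈τ pu v∈τ ¬pv
    T¬p : IsTableau τ (List.filter (¬? ∘ p?) τ) (List.filter (¬? ∘ ¬? ∘ p?) τ)
    T¬p = filter-tableau skew (¬? ∘ p?) ¬p-closed v∈τ ¬pv u∈τ (λ ¬pu → ¬pu pu)

  Crosses : ℤ → Node → Node → Set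
  Crosses r x y = row x ℤ.≤ r × r ℤ.< row y × col x ℤ.≤ col y

  crosses? : ∀ r x y → Dec (Crosses r x y)
  crosses? r x y = row x ℤ.≤? r ×-dec r ℤ.<? row y ×-dec col x ℤ.≤? col y

  row-link : ∀ {u v} → u ∈ τ → v ∈ τ → row u ℤ.< row v →
             ∃[ c ] (row u , c) ∈ τ × (row u ℤ.+ 1ℤ , c) ∈ τ
  row-link {u} {v} u∈τ v∈τ u<v with Any.any? (λ x → Any.any? (crosses? (row u) x) τ) τ
  ... | no no-crossing =
    ⊥-elim (indecomposable (λ x → row x ℤ.≤? row u) above-closed below-closed
                           u∈τ ℤ.≤-refl v∈τ (ℤ.<⇒≱ u<v))
    where
    above-closed : NWClosedIn τ (λ x → row x ℤ.≤ row u)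
    above-closed {x} {y} _ _ x↘y y≤r = ℤ.≤-trans (proj₁ (↘⇒≤ x y x↘y)) y≤r
    below-closed : NWClosedIn τ (λ x → ¬ row x ℤ.≤ row u)
    below-closed {x} {y} x∈τ y∈τ x↘y y≰r x≤r =
      no-crossing (lose x∈τ (lose y∈τ (x≤r , ℤ.≰⇒> y≰r , proj₂ (↘⇒≤ x y x↘y))))
  ... | yes crossing with find crossing
  ... | x , x∈τ , crossing-from-x with find crossing-from-x
  ... | y , y∈τ , x≤r , r<y , cx≤cy =
    col x ,
    between x∈τ y∈τ (≤⇒↘ x≤r ℤ.≤-refl) (≤⇒↘ (ℤ.<⇒≤ r<y) cx≤cy) ,
    between x∈τ y∈τ (≤⇒↘ (ℤ.≤-trans x≤r (ℤ.i≤i+j (row u) 1ℤ)) ℤ.≤-refl) (≤⇒↘ (i<j⇒i+1≤j r<y) cx≤cy)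

  private
    downward-path : ∀ n {u v} → u ∈ τ → v ∈ τ → row v ≡ row u ℤ.+ ℤ.+ n → Path u v
    downward-path zero u∈τ v∈τ row-v = row-path u∈τ v∈τ (sym (trans row-v (ℤ.+-identityʳ _)))
    downward-path (suc n) {u} u∈τ v∈τ row-v with row-link u∈τ v∈τ (subst (row u ℤ.<_) (sym row-v) u<v)
      where
      u<v : row u ℤ.< row u ℤ.+ ℤ.+ suc n
      u<v = ℤ.<-≤-trans (i<i+1 (row u)) (ℤ.+-monoʳ-≤ (row u) (ℤ.+≤+ (s≤s z≤n)))
    ... | c , w∈τ , w′∈τ =
      row-path u∈τ w∈τ refl ◅◅ (w∈τ , w′∈τ , inj₂ (refl , inj₁ refl)) ◅
      downward-path n w′∈τ v∈τ (trans row-v (sym (ℤ.+-assoc (row u) 1ℤ (ℤ.+ n))))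

  connected : IsConnected τ
  connected u v u∈τ v∈τ with ℤ.≤-total (row u) (row v)
  ... | inj₁ u≤v = let n , row-v = ≤⇒∃+ u≤v in downward-path n u∈τ v∈τ row-v
  ... | inj₂ v≤u = let n , row-u = ≤⇒∃+ v≤u in path-sym (downward-path n v∈τ u∈τ row-u)

  private
    row-⁺≰ : ∀ x → ¬ row (x ⁺) ℤ.≤ row x
    row-⁺≰ x = ℤ.<⇒≱ (i<i+1 (row x))

    lowest-node : ∀ {a} → a ∈ τ → ∃[ m ] m ∈ τ × m ⁺ ∉ τ
    lowest-node {a} a∈τ = m , argmax-all row a∈τ (All.tabulate id) ,
                          λ m⁺∈τ → row-⁺≰ m (All.lookup (f[xs]≤f[argmax] {f = row} a τ) m⁺∈τ)
      where
      m : Node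
      m = argmax row a τ

    highest-node : ∀ {a} → a ∈ τ → ∃[ m ] m ∈ τ × m ⁻ ∉ τ
    highest-node {a} a∈τ = m , argmin-all row a∈τ (All.tabulate id) ,
                           λ m⁻∈τ → row-⁺≰ (m ⁻) (subst (λ x → row x ℤ.≤ row (m ⁻)) (sym (⁺∘⁻ m))
                                                        (All.lookup (f[argmin]≤f[xs] {f = row} a τ) m⁻∈τ))
      where
      m : Node
      m = argmin row a τ

    HasSucc LacksPred : Node → Set
    HasSucc   v = v ⁺ ∈ τ
    LacksPred v = v ⁻ ∉ τ

    has-succ? : Decidable HasSucc
    has-succ? v = v ⁺ ∈? τ

    lacks-pred? : Decidable LacksPred
    lacks-pred? v = ¬? (v ⁻ ∈? τ)

    has-succ-closed : NWClosedIn τ HasSucc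
    has-succ-closed {u} {v} u∈τ _ u↘v v⁺∈τ = between u∈τ v⁺∈τ (↘⁺ u) (shift-mono 1ℤ u v u↘v)

    lacks-pred-closed : NWClosedIn τ LacksPred
    lacks-pred-closed {u} {v} _ v∈τ u↘v v⁻∉τ u⁻∈τ = v⁻∉τ (between u⁻∈τ v∈τ (shift-mono -1ℤ u v u↘v) (⁻↘ v))

    L-succ L-lacks L-pred : List Node
    L-succ  = List.filter has-succ? τ
    L-lacks = List.filter lacks-pred? τ
    L-pred  = List.filter (¬? ∘ lacks-pred?) τ

    has-pred≈shifted-has-succ : ∀ {v} → v ∈ L-pred ⇔ v ∈ List.map _⁺ L-succ
    has-pred≈shifted-has-succ {v} = mk⇔ to from
      where
      to : v ∈ L-pred → v ∈ List.map _⁺ L-succ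
      to v∈ with ∈-filter⁻ (¬? ∘ lacks-pred?) {xs = τ} v∈
      ... | v∈τ , ¬¬v⁻∈τ = subst (_∈ _) (⁺∘⁻ v) (∈-map⁺ _⁺ (∈-filter⁺ has-succ? v⁻∈τ v⁻⁺∈τ))
        where
        v⁻∈τ : v ⁻ ∈ τ
        v⁻∈τ = decidable-stable (v ⁻ ∈? τ) ¬¬v⁻∈τ
        v⁻⁺∈τ : v ⁻ ⁺ ∈ τ
        v⁻⁺∈τ = subst (_∈ τ) (sym (⁺∘⁻ v)) v∈τ
      from : v ∈ List.map _⁺ L-succ → v ∈ L-pred
      from v∈ with ∈-map⁻ _⁺ v∈
      ... | x , x∈ , refl with ∈-filter⁻ has-succ? {xs = τ} x∈
      ... | x∈τ , x⁺∈τ =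
        ∈-filter⁺ (¬? ∘ lacks-pred?) x⁺∈τ (λ x⁺⁻∉τ → x⁺⁻∉τ (subst (_∈ τ) (sym (⁻∘⁺ x)) x∈τ))

  no-diagonal-neighbours : ∀ {a} → a ∈ τ → a ⁺ ∈ τ → ⊥
  no-diagonal-neighbours {a} a∈τ a⁺∈τ = first-parts-not-complementary T-succ T-pred (begin
    cont e L-succ ⊕ cont e L-lacks    ≡⟨ ⊕-comm (cont e L-succ) _ ⟩
    cont e L-lacks ⊕ cont e L-succ    ≡⟨ cong (cont e L-lacks ⊕_) shifted ⟨
    cont e L-lacks ⊕ cont e L-pred   ≡⟨ cont-tableau (proj₁ skew) T-pred ⟨
    cont e τ                          ∎)
    where
    open ≡-Reasoning
    T-succ : IsTableau τ L-succ (List.filter (¬? ∘ has-succ?) τ)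
    T-succ = let m , m∈τ , m⁺∉τ = lowest-node a∈τ in
             filter-tableau skew has-succ? has-succ-closed a∈τ a⁺∈τ m∈τ m⁺∉τ
    T-pred : IsTableau τ L-lacks L-pred
    T-pred = let m , m∈τ , m⁻∉τ = highest-node a∈τ in
             filter-tableau skew lacks-pred? lacks-pred-closed m∈τ m⁻∉τ a⁺∈τ
                            (λ a⁺⁻∉τ → a⁺⁻∉τ (subst (_∈ τ) (sym (⁻∘⁺ a)) a∈τ))
    shifted : cont e L-pred ≡ cont e L-succ
    shifted = trans (cont-sameSet (Unique.filter⁺ (¬? ∘ lacks-pred?) (proj₁ skew))
                                  (Unique.map⁺ ⁺-injective (Unique.filter⁺ has-succ? (proj₁ skew)))
                                  has-pred≈shifted-has-succ)
                    (cont-map _⁺ diag-⁺ L-succ)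

  private
    same-diagonal-below : ∀ {u v} → u ∈ τ → v ∈ τ → diag u ≡ diag v → row u ℤ.≤ row v → u ≡ v
    same-diagonal-below {u} {v} u∈τ v∈τ diag≡ u≤v with diag≡⇒shift u v diag≡ u≤v
    ... | zero  , refl = sym (shift-0 u)
    ... | suc k , refl =
      ⊥-elim (no-diagonal-neighbours u∈τ (between u∈τ v∈τ (↘⁺ u) (shift-↘ u (ℤ.+≤+ (s≤s z≤n)))))

  thin : IsThin τ
  thin u v u∈τ v∈τ diag≡ with ℤ.≤-total (row u) (row v)
  ... | inj₁ u≤v = same-diagonal-below u∈τ v∈τ diag≡ u≤v
  ... | inj₂ v≤u = sym (same-diagonal-below v∈τ u∈τ (sym diag≡) v≤u)

lemma6p7 : (e : ℕ) .{{_ : NonZero e}} → 2 ≤ e → (P : ConvexPreorder e) →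
           (τ : List Node) → IsCuspidal e P τ → IsRibbon τ
lemma6p7 e _ P τ cusp = Contents.posRoot-cont⇒nonEmpty e τ (proj₁ (proj₂ cusp)) , thin , connected , skew
  where open Cuspidal P cusp
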